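{- Let $\Psi$ be a context of parameters with positive types and $N$ a simple linear pattern with $\Psi\vdash N\Uparrow A$. Then for every closed $M$ with $\Psi\vdash M\Uparrow A$, either $\Psi\vdash M\in\|N\|:A$, or there is a $Q$ such that $\Psi\vdash\mathrm{Not}(N)\Rightarrow Q:A$ and $\Psi\vdash M\in\|Q\|:A$.
   Context: Strict $\lambda$-calculus over a signature $\Sigma$: labels $k\in\{1,0,u\}$; types $A::=a\mid A_1\to^kA_2$; terms $c\mid x\mid\lambda x^k{:}A.M\mid M_1M_2^k$. Typing $\Gamma;\Omega;\Delta\vdash M:A$ (unrestricted, irrelevant, strict; disjoint; commas are disjoint unions): $c{:}A\in\Sigma$ gives $\Gamma;\Omega;\cdot\vdash c:A$; $(\Gamma,x{:}A);\Omega;\cdot\vdash x:A$; $\Gamma;\Omega;x{:}A\vdash x:A$ (no rule for $\Omega$); $\lambda x^u,\lambda x^0,\lambda x^1$ typed at $A\to^uB,A\to^0B,A\to^1B$ from the body typed at $B$ with $x{:}A$ added to $\Gamma,\Omega,\Delta$ respectively; $\Gamma;\Omega;\Delta\vdash MN^u:B$ from $\Gamma;\Omega;\Delta\vdash M:A\to^uB$ and $(\Gamma,\Delta);\Omega;\cdot\vdash N:A$; $\Gamma;\Omega;\Delta\vdash MN^0:B$ from $\Gamma;\Omega;\Delta\vdash M:A\to^0B$ and $(\Gamma,\Omega,\Delta);\cdot;\cdot\vdash N:A$; $\Gamma;\Omega;(\Delta_M,\Delta_N)\vdash MN^1:B$ from $(\Gamma,\Delta_N);\Omega;\Delta_M\vdash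 M:A\to^1B$ and $(\Gamma,\Delta_M);\Omega;\Delta_N\vdash N:A$. Simple patterns: positive $P::=a\mid N\to^1P$, negative $N::=a\mid P\to^uN$; $\Sigma,\Psi$ declare positive types; existential variables are a separate class. For $\Psi=x_1{:}A_1,\dots,x_n{:}A_n$ (fixed order) $\Phi=x_1^{k_1}\dots x_n^{k_n}$, $\Phi(x_i)=k_i$, $\Psi^u$ all labels $u$; $\Gamma;\Omega;\Delta\vdash\Phi\ ok$ iff $\Gamma,\Omega,\Delta$ partition $\Psi$ with $x$ in $\Gamma/\Omega/\Delta$ iff $\Phi(x)=u/0/1$. Generalized variable $E\,\Phi$ at atomic $a$, $E{:}A_1\to^{k_1}\cdots A_n\to^{k_n}a$. $\Psi\vdash M\Uparrow A$: $\lambda x^u{:}P.M\Uparrow P\to^uB$ if $(\Psi,x{:}P)\vdash M\Uparrow B$; $h\,M_1^1\dots M_n^1\Uparrow a$ for $h\in\mathrm{dom}(\Sigma\cup\Psi)$ of type $A_1\to^1\cdots\to^1A_n\to^1a$ with $M_i\Uparrow A_i$; $E\,\Phi\Uparrow a$. Linear: no existential variable twice; closed: none. Convention: fresh $Z\,\Phi$ at non-atomic type $B_1\to^u\cdots\to^uB_m\to^ua$ means $\lambda y_1^u{:}B_1\dots\lambda y_m^u{:}B_m.Z\,\Phi\,y_1^u\dots y_m^u$. Ground instances (closed $M$): $\Gamma;\Omega;\Delta\vdash\Phi\ ok$ and $\Gamma;\Omega;\Delta\vdash M:a$ give $\Psi\vdash M\in\|E\Phi\|:a$; $(\Psi,x{:}A)\vdash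 M\in\|N\|:B$ gives $\Psi\vdash\lambda x^u{:}A.M\in\|\lambda x^u{:}A.N\|:A\to^uB$; $h{:}A_1\to^1\cdots\to^1A_n\to^1a$ in $\Sigma\cup\Psi$ and $\Psi\vdash M_i\in\|N_i\|:A_i$ give $\Psi\vdash h\,M_1^1\dots M_n^1\in\|h\,N_1^1\dots N_n^1\|:a$. Complement ($Z$'s fresh; $\mathrm{Not}(1)=0$, $\mathrm{Not}(0)=1$, $\mathrm{Not}(u)=u$; $\mathrm{Not}_i(\Phi)$, defined when $\Phi(x_i)\in\{0,1\}$, labels $x_i$ by $\mathrm{Not}(\Phi(x_i))$ and all others $u$): $\Psi\vdash\mathrm{Not}(E\Phi)\Rightarrow Z\,\mathrm{Not}_i(\Phi):a$ when defined; if $(\Psi,x{:}A)\vdash\mathrm{Not}(M)\Rightarrow N:B$ then $\Psi\vdash\mathrm{Not}(\lambda x^u{:}A.M)\Rightarrow\lambda x^u{:}A.N:A\to^uB$; for $h{:}A_1\to^1\cdots\to^1A_n\to^1a$ in $\Sigma\cup\Psi$: $\Psi\vdash\mathrm{Not}(h\,M_1^1\dots M_n^1)\Rightarrow g\,(Z_1\Psi^u)^1\dots(Z_m\Psi^u)^1:a$ for any $g\ne h$ in $\Sigma\cup\Psi$ of type $A'_1\to^1\cdots\to^1A'_m\to^1a$; and if $\Psi\vdash\mathrm{Not}(M_i)\Rightarrow N:A_i$ then $\Psi\vdash\mathrm{Not}(h\,M_1^1\dots M_n^1)\Rightarrow h\,(Z_1\Psi^u)^1\dots(Z_{i-1}\Psi^u)^1N^1(Z_{i+1}\Psi^u)^1\dots(Z_n\Psi^u)^1:a$.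 -}

module Defs where

open import Data.Nat using (ℕ; suc)
open import Data.Fin using (Fin)
open import Data.List using (List) renaming ([] to []ᴸ; _∷_ to _∷ᴸ_)
open import Data.Vec using (Vec; []; _∷_; lookup; replicate; map; _[_]≔_)
open import Relation.Binary.PropositionalEquality using (_≡_; _≢_)

data Lab : Set where
  l1 l0 lu : Lab

notL : Lab → Lab
notL l1 = l0
notL l0 = l1
notL lu = lu

infixr 5 _⇒[_]_
data Ty : Set where
  base   : ℕ → Ty
  _⇒[_]_ : Ty → Lab → Ty → Ty

data Pos : Ty → Set
data Neg : Ty → Set
data Pos where
  pos-base : ∀ {a} → Pos (base a)
  pos-arr  : ∀ {N P} → Neg N → Pos P → Pos (N ⇒[ l1 ] P)
data Neg where
  neg-base : ∀ {a} → Neg (base a)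
  neg-arr  : ∀ {P N} → Pos P → Neg N → Neg (P ⇒[ lu ] N)

-- Heads: constants of Σ (named by their position in Σ) or parameters of Ψ
-- (de Bruijn indices into the current parameter context of length n).
data Head (n : ℕ) : Set where
  con : ℕ → Head n
  par : Fin n → Head n

-- Terms over a parameter context of length n.  evar Φ is a generalized
-- variable E Φ; Φ labels every variable of the context.  Existential
-- variables carry no name.
data Tm (n : ℕ) : Set where
  hd   : Head n → Tm n
  lam  : Lab → Ty → Tm (suc n) → Tm n
  app  : Tm n → Lab → Tm n → Tm n
  evar : Vec Lab n → Tm n

data Closed {n : ℕ} : Tm n → Set where
  cl-hd  : ∀ {h} → Closed (hd h)
  cl-lam : ∀ {k A M} → Closed M → Closed (lam k A M)
  cl-app : ∀ {M k N} → Closed M → Closed N → Closed (app M k N)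

data _∋_∶_ : List Ty → ℕ → Ty → Set where
  here  : ∀ {A As} → (A ∷ᴸ As) ∋ 0 ∶ A
  there : ∀ {A B As c} → As ∋ c ∶ A → (B ∷ᴸ As) ∋ suc c ∶ A

-- role vectors: variable i is in Γ / Ω / Δ iff R[i] = u / 0 / 1
NoLin : ∀ {n} → Vec Lab n → Set
NoLin {n} R = ∀ (i : Fin n) → lookup R i ≢ l1

unlinL : Lab → Lab
unlinL l1 = lu
unlinL k  = k

-- Δ_M , Δ_N splitting: Split R RM RN  (RM moves Δ_N into Γ, RN moves Δ_M into Γ)
data Split : ∀ {n} → Vec Lab n → Vec Lab n → Vec Lab n → Set where
  sp-[]  : Split [] [] []
  sp-u   : ∀ {n} {R RM RN : Vec Lab n} → Split R RM RN → Split (lu ∷ R) (lu ∷ RM) (lu ∷ RN)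
  sp-0   : ∀ {n} {R RM RN : Vec Lab n} → Split R RM RN → Split (l0 ∷ R) (l0 ∷ RM) (l0 ∷ RN)
  sp-1M  : ∀ {n} {R RM RN : Vec Lab n} → Split R RM RN → Split (l1 ∷ R) (l1 ∷ RM) (lu ∷ RN)
  sp-1N  : ∀ {n} {R RM RN : Vec Lab n} → Split R RM RN → Split (l1 ∷ R) (lu ∷ RM) (l1 ∷ RN)

module _ (Sg : List Ty) where

  data HeadTy {n} (Ψ : Vec Ty n) : Head n → Ty → Set where
    ht-con : ∀ {c A} → Sg ∋ c ∶ A → HeadTy Ψ (con c) A
    ht-par : ∀ {x} → HeadTy Ψ (par x) (lookup Ψ x)

  data Typed {n} (Ψ : Vec Ty n) : Vec Lab n → Tm n → Ty → Set where
    t-con  : ∀ {R c A} → Sg ∋ c ∶ A → NoLin R → Typed Ψ R (hd (con c)) A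
    t-varu : ∀ {R x} → lookup R x ≡ lu → NoLin R → Typed Ψ R (hd (par x)) (lookup Ψ x)
    t-var1 : ∀ {R x} → lookup R x ≡ l1 → (∀ j → j ≢ x → lookup R j ≢ l1) →
             Typed Ψ R (hd (par x)) (lookup Ψ x)
    t-lam  : ∀ {R k A M B} → Typed (A ∷ Ψ) (k ∷ R) M B → Typed Ψ R (lam k A M) (A ⇒[ k ] B)
    t-appu : ∀ {R M N A B} → Typed Ψ R M (A ⇒[ lu ] B) → Typed Ψ (map unlinL R) N A →
             Typed Ψ R (app M lu N) B
    t-app0 : ∀ {R M N A B} → Typed Ψ R M (A ⇒[ l0 ] B) → Typed Ψ (replicate n lu) N A →
             Typed Ψ R (app M l0 N) B
    t-app1 : ∀ {R RM RN M N A B} → Split R RM RN → Typed Ψ RM M (A ⇒[ l1 ] B) →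
             Typed Ψ RN N A → Typed Ψ R (app M l1 N) B

  data _⊢_⇑_ {n} (Ψ : Vec Ty n) : Tm n → Ty → Set
  data _⊢_⇑ₛ_ {n} (Ψ : Vec Ty n) : Tm n → Ty → Set
  data _⊢_⇑_ {n} Ψ where
    ⇑-lam  : ∀ {P M B} → (P ∷ Ψ) ⊢ M ⇑ B → Ψ ⊢ lam lu P M ⇑ (P ⇒[ lu ] B)
    ⇑-sp   : ∀ {M a} → Ψ ⊢ M ⇑ₛ base a → Ψ ⊢ M ⇑ base a
    ⇑-evar : ∀ {Φ a} → Ψ ⊢ evar Φ ⇑ base a
  data _⊢_⇑ₛ_ {n} Ψ where
    ⇑ₛ-hd  : ∀ {h A} → HeadTy Ψ h A → Ψ ⊢ hd h ⇑ₛ A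
    ⇑ₛ-app : ∀ {M N A B} → Ψ ⊢ M ⇑ₛ (A ⇒[ l1 ] B) → Ψ ⊢ N ⇑ A → Ψ ⊢ app M l1 N ⇑ₛ B

  data _⊢_∈∥_∥∶_ {n} (Ψ : Vec Ty n) : Tm n → Tm n → Ty → Set
  data _⊢_∈∥_∥ₛ_ {n} (Ψ : Vec Ty n) : Tm n → Tm n → Ty → Set
  data _⊢_∈∥_∥∶_ {n} Ψ where
    ∈-evar : ∀ {Φ M a} → Typed Ψ Φ M (base a) → Ψ ⊢ M ∈∥ evar Φ ∥∶ base a
    ∈-lam  : ∀ {A M N B} → (A ∷ Ψ) ⊢ M ∈∥ N ∥∶ B →
             Ψ ⊢ lam lu A M ∈∥ lam lu A N ∥∶ (A ⇒[ lu ] B)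
    ∈-sp   : ∀ {M N a} → Ψ ⊢ M ∈∥ N ∥ₛ base a → Ψ ⊢ M ∈∥ N ∥∶ base a
  data _⊢_∈∥_∥ₛ_ {n} Ψ where
    ∈ₛ-hd  : ∀ {h A} → HeadTy Ψ h A → Ψ ⊢ hd h ∈∥ hd h ∥ₛ A
    ∈ₛ-app : ∀ {M N M′ N′ A B} → Ψ ⊢ M ∈∥ N ∥ₛ (A ⇒[ l1 ] B) → Ψ ⊢ M′ ∈∥ N′ ∥∶ A →
             Ψ ⊢ app M l1 M′ ∈∥ app N l1 N′ ∥ₛ B

  -- fresh  Z Φ  at type B₁ →ᵘ … →ᵘ Bₘ →ᵘ a, η-expanded:
  -- λy₁ᵘ:B₁ … λyₘᵘ:Bₘ. Z Φ y₁ᵘ … yₘᵘ   (the y's are labelled u)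
  data Fresh : ∀ {n} → Vec Lab n → Ty → Tm n → Set where
    fr-base : ∀ {n} {Φ : Vec Lab n} {a} → Fresh Φ (base a) (evar Φ)
    fr-arr  : ∀ {n} {Φ : Vec Lab n} {A B T} → Fresh (lu ∷ Φ) B T →
              Fresh Φ (A ⇒[ lu ] B) (lam lu A T)

  data HSp {n} (Ψ : Vec Ty n) : Tm n → Head n → Ty → Set where
    hsp-hd  : ∀ {h A} → HeadTy Ψ h A → HSp Ψ (hd h) h A
    hsp-app : ∀ {M h M′ A B} → HSp Ψ M h (A ⇒[ l1 ] B) → HSp Ψ (app M l1 M′) h B

  data FreshSp {n} (Ψ : Vec Ty n) : Tm n → Head n → Ty → Set where
    fs-hd  : ∀ {g A} → HeadTy Ψ g A → FreshSp Ψ (hd g) g A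
    fs-app : ∀ {T g Z A B} → FreshSp Ψ T g (A ⇒[ l1 ] B) → Fresh (replicate n lu) A Z →
             FreshSp Ψ (app T l1 Z) g B

  data FSp {n} (Ψ : Vec Ty n) : Tm n → Tm n → Head n → Ty → Set where
    fsp-hd  : ∀ {h A} → HeadTy Ψ h A → FSp Ψ (hd h) (hd h) h A
    fsp-app : ∀ {M T h M′ Z A B} → FSp Ψ M T h (A ⇒[ l1 ] B) → Fresh (replicate n lu) A Z →
              FSp Ψ (app M l1 M′) (app T l1 Z) h B

  data _⊢Not_⇒_∶_ {n} (Ψ : Vec Ty n) : Tm n → Tm n → Ty → Set
  data NSp {n} (Ψ : Vec Ty n) : Tm n → Tm n → Ty → Set
  data _⊢Not_⇒_∶_ {n} Ψ where
    not-evar : ∀ {Φ a} (i : Fin n) → lookup Φ i ≢ lu →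
               Ψ ⊢Not evar Φ ⇒ evar (replicate n lu [ i ]≔ notL (lookup Φ i)) ∶ base a
    not-lam  : ∀ {A M N B} → (A ∷ Ψ) ⊢Not M ⇒ N ∶ B →
               Ψ ⊢Not lam lu A M ⇒ lam lu A N ∶ (A ⇒[ lu ] B)
    not-head : ∀ {M T h g a} → HSp Ψ M h (base a) → FreshSp Ψ T g (base a) → g ≢ h →
               Ψ ⊢Not M ⇒ T ∶ base a
    not-arg  : ∀ {M T a} → NSp Ψ M T (base a) → Ψ ⊢Not M ⇒ T ∶ base a
  data NSp {n} Ψ where
    nsp-here  : ∀ {M T h Mi N A B} → FSp Ψ M T h (A ⇒[ l1 ] B) → Ψ ⊢Not Mi ⇒ N ∶ A →
                NSp Ψ (app M l1 Mi) (app T l1 N) B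
    nsp-later : ∀ {M T Mj Z A B} → NSp Ψ M T (A ⇒[ l1 ] B) → Fresh (replicate n lu) A Z →
                NSp Ψ (app M l1 Mj) (app T l1 Z) B

{-# OPTIONS --safe #-}
-- For a closed simple term M, typing under roles Φ depends only on which parameters occur in M:
-- it holds iff every strict parameter occurs and no irrelevant one does, because in a spine each
-- strict parameter can be handed to an argument in which it occurs.  So M is either an instance of
-- E Φ or violates Φ at some xᵢ, and then it is an instance of Z Notᵢ(Φ).  For the other patterns
-- compare heads: distinct heads give the head-changing complement; equal heads force equal argument
-- types (the type of the head determines its spine), and the leftmost argument that does not match
-- gives the complement at that position, all other arguments being covered by fresh Z Ψᵘ.
module Submission where

open import Defs
open import Data.Bool using (Bool; true; false; not; _∨_; if_then_else_)
open import Data.Fin using (Fin; zero; suc)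
import Data.Fin.Properties as Fin
open import Data.List using (List)
import Data.List.Relation.Unary.All as LAll
open import Data.Nat using (ℕ)
import Data.Nat.Properties as ℕ
open import Data.Product using (∃; _×_; _,_)
open import Data.Sum using (_⊎_; inj₁; inj₂)
open import Data.Vec using (Vec; _∷_; []; lookup; replicate; tabulate; _[_]≔_)
open import Data.Vec.Properties
  using (lookup∘tabulate; lookup∘update; lookup∘update′; lookup-replicate)
import Data.Vec.Relation.Unary.All as VAll
open import Function using (_∘_)
open import Relation.Binary.Definitions using (DecidableEquality)
open import Relation.Binary.PropositionalEquality using (_≡_; _≢_; refl; sym; trans; cong; subst)
open import Relation.Nullary using (¬_; Dec; yes; no; contradiction)
open import Relation.Nullary.Decidable using (does; dec-true; map′)

private
  variable
    n     : ℕ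
    k     : Lab
    b     : Bool
    A A′ B H : Ty
    x     : Fin n
    h     : Head n
    R     : Vec Lab n
    Ψ     : Vec Ty n
    M M′ N : Tm n

occurs : Fin n → Tm n → Bool
occurs i (hd (con _)) = false
occurs i (hd (par x)) = does (i Fin.≟ x)
occurs i (lam _ _ M)  = occurs (suc i) M
occurs i (app M _ N)  = occurs i M ∨ occurs i N
occurs i (evar _)     = false

occurs-par : {i : Fin n} → occurs i (hd (par x)) ≡ true → i ≡ x
occurs-par {x = x} {i} _ with i Fin.≟ x
... | yes i≡x = i≡x
occurs-par () | no _

occurs-par-self : (x : Fin n) → occurs x (hd (par x)) ≡ true
occurs-par-self x = dec-true (x Fin.≟ x) refl

data Agrees : Lab → Bool → Set where
  strict-occurs     : Agrees l1 true
  irrelevant-absent : Agrees l0 false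
  unrestricted      : Agrees lu b

agrees? : ∀ k b → Dec (Agrees k b)
agrees? l1 true  = yes strict-occurs
agrees? l1 false = no λ ()
agrees? l0 true  = no λ ()
agrees? l0 false = yes irrelevant-absent
agrees? lu _     = yes unrestricted

agrees-strict : Agrees k b → k ≡ l1 → b ≡ true
agrees-strict strict-occurs refl = refl

agrees-irrelevant : Agrees k b → k ≡ l0 → b ≡ false
agrees-irrelevant irrelevant-absent refl = refl

disagrees⇒notL-agrees : ¬ Agrees k b → k ≢ lu × Agrees (notL k) b
disagrees⇒notL-agrees {l1} {true}  ¬ok = contradiction strict-occurs ¬ok
disagrees⇒notL-agrees {l1} {false} _   = (λ ()) , irrelevant-absent
disagrees⇒notL-agrees {l0} {true}  _   = (λ ()) , strict-occurs
disagrees⇒notL-agrees {l0} {false} ¬ok = contradiction irrelevant-absent ¬ok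
disagrees⇒notL-agrees {lu}         ¬ok = contradiction unrestricted ¬ok

record Consistent (R : Vec Lab n) (M : Tm n) : Set where
  constructor consistent
  field agrees-at : ∀ i → Agrees (lookup R i) (occurs i M)
open Consistent

consistent-at? : (R : Vec Lab n) (M : Tm n) (i : Fin n) → Dec (Agrees (lookup R i) (occurs i M))
consistent-at? R M i = agrees? (lookup R i) (occurs i M)

consistent-or-violated : (R : Vec Lab n) (M : Tm n) →
                         Consistent R M ⊎ ∃ λ i → ¬ Agrees (lookup R i) (occurs i M)
consistent-or-violated {n} R M with Fin.all? (consistent-at? R M)
... | yes R✓ = inj₁ (consistent R✓)
... | no ¬R✓ = inj₂ (Fin.¬∀⟶∃¬ n _ (consistent-at? R M) ¬R✓)

consistent-tabulate : {f : Fin n → Lab} → (∀ i → Agrees (f i) (occurs i M)) →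
                      Consistent (tabulate f) M
consistent-tabulate {f = f} ok =
  consistent λ i → subst (λ k → Agrees k _) (sym (lookup∘tabulate f i)) (ok i)

consistent-unrestricted : Consistent (replicate n lu) M
consistent-unrestricted {M = M} =
  consistent λ i → subst (λ k → Agrees k (occurs i M)) (sym (lookup-replicate i lu)) unrestricted

consistent-update : ∀ i {y} → Agrees y (occurs i M) → Consistent (replicate n lu [ i ]≔ y) M
consistent-update {n = n} {M = M} i {y} ok = consistent agrees-at-j
  where
  agrees-at-j : ∀ j → Agrees (lookup (replicate n lu [ i ]≔ y) j) (occurs j M)
  agrees-at-j j with j Fin.≟ i
  ... | yes refl = subst (λ k → Agrees k _) (sym (lookup∘update i (replicate n lu) y)) ok
  ... | no j≢i   = subst (λ k → Agrees k _) (sym (lookup∘update′ j≢i (replicate n lu) y))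
                         (agrees-at (consistent-unrestricted {M = M}) j)

consistent-lam : Consistent R (lam k A M) → Consistent (lu ∷ R) M
consistent-lam R✓ = consistent λ where
  zero    → unrestricted
  (suc i) → agrees-at R✓ i

keepIf : Bool → Lab → Lab
keepIf b k = if b then k else unlinL k

splitˡ splitʳ : Vec Lab n → (Fin n → Bool) → Vec Lab n
splitˡ R toLeft = tabulate λ i → keepIf (toLeft i) (lookup R i)
splitʳ R toLeft = tabulate λ i → keepIf (not (toLeft i)) (lookup R i)

split-∷ : {RM RN : Vec Lab n} → ∀ k b → Split R RM RN →
          Split (k ∷ R) (keepIf b k ∷ RM) (keepIf (not b) k ∷ RN)
split-∷ l1 true  = sp-1M
split-∷ l1 false = sp-1N
split-∷ l0 true  = sp-0
split-∷ l0 false = sp-0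
split-∷ lu true  = sp-u
split-∷ lu false = sp-u

split-by : (R : Vec Lab n) (toLeft : Fin n → Bool) → Split R (splitˡ R toLeft) (splitʳ R toLeft)
split-by []      _      = sp-[]
split-by (k ∷ R) toLeft = split-∷ k (toLeft zero) (split-by R (toLeft ∘ suc))

agrees-keepˡ : ∀ b c → Agrees k (b ∨ c) → Agrees (keepIf b k) b
agrees-keepˡ true  _ strict-occurs     = strict-occurs
agrees-keepˡ true  _ unrestricted      = unrestricted
agrees-keepˡ false _ strict-occurs     = unrestricted
agrees-keepˡ false _ irrelevant-absent = irrelevant-absent
agrees-keepˡ false _ unrestricted      = unrestricted

agrees-keepʳ : ∀ b c → Agrees k (b ∨ c) → Agrees (keepIf (not b) k) c
agrees-keepʳ true  _ strict-occurs = unrestricted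
agrees-keepʳ true  _ unrestricted  = unrestricted
agrees-keepʳ false _ ok            = ok

consistent-splitˡ : Consistent R (app M k N) → Consistent (splitˡ R (λ i → occurs i M)) M
consistent-splitˡ {M = M} {N = N} R✓ =
  consistent-tabulate λ i → agrees-keepˡ (occurs i M) (occurs i N) (agrees-at R✓ i)

consistent-splitʳ : Consistent R (app M k N) → Consistent (splitʳ R (λ i → occurs i M)) N
consistent-splitʳ {M = M} {N = N} R✓ =
  consistent-tabulate λ i → agrees-keepʳ (occurs i M) (occurs i N) (agrees-at R✓ i)

consistent-par-strict : Consistent R (hd (par x)) → ∀ j → lookup R j ≡ l1 → j ≡ x
consistent-par-strict R✓ j j-strict = occurs-par (agrees-strict (agrees-at R✓ j) j-strict)

consistent-par-noLin : Consistent R (hd (par x)) → lookup R x ≢ l1 → NoLin R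
consistent-par-noLin R✓ x-not-strict j j-strict with refl ← consistent-par-strict R✓ j j-strict =
  x-not-strict j-strict

consistent-par-relevant : Consistent R (hd (par x)) → lookup R x ≢ l0
consistent-par-relevant {x = x} R✓ x-irrelevant =
  contradiction (trans (sym (occurs-par-self x)) (agrees-irrelevant (agrees-at R✓ x) x-irrelevant))
                λ ()

infix 4 _≼_
data _≼_ : Ty → Ty → Set where
  ≼-refl : H ≼ H
  ≼-step : B ≼ H → B ≼ A ⇒[ l1 ] H

≼-cod : A ⇒[ l1 ] B ≼ H → B ≼ H
≼-cod ≼-refl     = ≼-step ≼-refl
≼-cod (≼-step s) = ≼-step (≼-cod s)

≼-¬arrow : ¬ (A ⇒[ l1 ] B ≼ B)
≼-¬arrow (≼-step s) = ≼-¬arrow (≼-cod s)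

≼-dom-unique : A ⇒[ l1 ] B ≼ H → A′ ⇒[ l1 ] B ≼ H → A ≡ A′
≼-dom-unique ≼-refl     ≼-refl      = refl
≼-dom-unique ≼-refl     (≼-step s)  = contradiction s ≼-¬arrow
≼-dom-unique (≼-step s) ≼-refl      = contradiction s ≼-¬arrow
≼-dom-unique (≼-step s) (≼-step s′) = ≼-dom-unique s s′

∋-unique : ∀ {Sg c} → Sg ∋ c ∶ A → Sg ∋ c ∶ B → A ≡ B
∋-unique here      here      = refl
∋-unique (there p) (there q) = ∋-unique p q

_≟ₕ_ : DecidableEquality (Head n)
con c ≟ₕ con d = map′ (cong con) (λ { refl → refl }) (c ℕ.≟ d)
con _ ≟ₕ par _ = no λ ()
par _ ≟ₕ con _ = no λ ()
par x ≟ₕ par y = map′ (cong par) (λ { refl → refl }) (x Fin.≟ y)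

module _ (Sg : List Ty) where

  typed-par : Consistent R (hd (par x)) → Typed Sg Ψ R (hd (par x)) (lookup Ψ x)
  typed-par {R = R} {x = x} R✓ with lookup R x in Rx
  ... | l1 = t-var1 Rx λ j j≢x j-strict → j≢x (consistent-par-strict R✓ j j-strict)
  ... | lu = t-varu Rx (consistent-par-noLin R✓ λ x-strict →
                          contradiction (trans (sym Rx) x-strict) λ ())
  ... | l0 = contradiction Rx (consistent-par-relevant R✓)

  typed-if-consistent  : Closed M → _⊢_⇑_ Sg Ψ M A → Consistent R M → Typed Sg Ψ R M A
  typedₛ-if-consistent : Closed M → _⊢_⇑ₛ_ Sg Ψ M A → Consistent R M → Typed Sg Ψ R M A
  typed-if-consistent (cl-lam c) (⇑-lam p) R✓ = t-lam (typed-if-consistent c p (consistent-lam R✓))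
  typed-if-consistent c          (⇑-sp s)  R✓ = typedₛ-if-consistent c s R✓
  typedₛ-if-consistent _ (⇑ₛ-hd (ht-con c∶A)) R✓ =
    t-con c∶A λ i i-strict → contradiction (agrees-strict (agrees-at R✓ i) i-strict) λ ()
  typedₛ-if-consistent _ (⇑ₛ-hd ht-par)       R✓ = typed-par R✓
  typedₛ-if-consistent (cl-app cM cN) (⇑ₛ-app sM pN) R✓ =
    t-app1 (split-by _ _) (typedₛ-if-consistent cM sM (consistent-splitˡ R✓))
                          (typed-if-consistent cN pN (consistent-splitʳ R✓))

  headTy-unique : HeadTy Sg Ψ h A → HeadTy Sg Ψ h B → A ≡ B
  headTy-unique (ht-con c∶A) (ht-con c∶B) = ∋-unique c∶A c∶B
  headTy-unique ht-par       ht-par       = refl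

  hsp-type : HSp Sg Ψ M h B → ∃ λ H → HeadTy Sg Ψ h H × B ≼ H
  hsp-type (hsp-hd h∶H) = _ , h∶H , ≼-refl
  hsp-type (hsp-app sp) with H , h∶H , AB≼H ← hsp-type sp = H , h∶H , ≼-cod AB≼H

  hsp-dom-unique : HSp Sg Ψ M h (A ⇒[ l1 ] B) → HSp Sg Ψ M′ h (A′ ⇒[ l1 ] B) → A ≡ A′
  hsp-dom-unique sp sp′
    with H , h∶H , AB≼H ← hsp-type sp | H′ , h∶H′ , A′B≼H′ ← hsp-type sp′
    with refl ← headTy-unique h∶H h∶H′
    = ≼-dom-unique AB≼H A′B≼H′

  hsp-¬arrow : HeadTy Sg Ψ h B → ¬ HSp Sg Ψ M h (A ⇒[ l1 ] B)
  hsp-¬arrow h∶B sp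
    with H , h∶H , AB≼H ← hsp-type sp
    with refl ← headTy-unique h∶B h∶H
    = ≼-¬arrow AB≼H

  spine-head : {M : Tm n} → _⊢_⇑ₛ_ Sg Ψ M B → Head n
  spine-head (⇑ₛ-hd {h} _) = h
  spine-head (⇑ₛ-app s _)  = spine-head s

  spine-hsp : (s : _⊢_⇑ₛ_ Sg Ψ M B) → HSp Sg Ψ M (spine-head s) B
  spine-hsp (⇑ₛ-hd h∶B)  = hsp-hd h∶B
  spine-hsp (⇑ₛ-app s _) = hsp-app (spine-hsp s)

  spine-dom-unique : (sN : _⊢_⇑ₛ_ Sg Ψ N (A ⇒[ l1 ] B)) →
                     (sM : _⊢_⇑ₛ_ Sg Ψ M (A′ ⇒[ l1 ] B)) →
                     spine-head sN ≡ spine-head sM → A ≡ A′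
  spine-dom-unique sN sM same-head =
    hsp-dom-unique (spine-hsp sN) (subst (λ h → HSp Sg _ _ h _) (sym same-head) (spine-hsp sM))

  spine-¬hd-app : HeadTy Sg Ψ h B → (s : _⊢_⇑ₛ_ Sg Ψ M (A ⇒[ l1 ] B)) → h ≢ spine-head s
  spine-¬hd-app h∶B s h≡head =
    hsp-¬arrow h∶B (subst (λ h → HSp Sg _ _ h _) (sym h≡head) (spine-hsp s))

  fresh-covers : Closed M → _⊢_⇑_ Sg Ψ M A →
                 ∃ λ Z → Fresh Sg (replicate n lu) A Z × _⊢_∈∥_∥∶_ Sg Ψ M Z A
  fresh-covers (cl-lam c) (⇑-lam p) with Z , fresh , M∈Z ← fresh-covers c p =
    lam lu _ Z , fr-arr fresh , ∈-lam M∈Z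
  fresh-covers c (⇑-sp s) =
    evar _ , fr-base , ∈-evar (typedₛ-if-consistent c s consistent-unrestricted)

  freshSp-covers : Closed M → (s : _⊢_⇑ₛ_ Sg Ψ M B) →
                   ∃ λ T → FreshSp Sg Ψ T (spine-head s) B × _⊢_∈∥_∥ₛ_ Sg Ψ M T B
  freshSp-covers _ (⇑ₛ-hd h∶B) = hd _ , fs-hd h∶B , ∈ₛ-hd h∶B
  freshSp-covers (cl-app cM cM′) (⇑ₛ-app s p)
    with T , fresh-spine , M∈T ← freshSp-covers cM s
       | Z , fresh , M′∈Z ← fresh-covers cM′ p
    = app T l1 Z , fs-app fresh-spine fresh , ∈ₛ-app M∈T M′∈Z

  fsp-covers : (sN : _⊢_⇑ₛ_ Sg Ψ N B) → Closed M → (sM : _⊢_⇑ₛ_ Sg Ψ M B) →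
               spine-head sN ≡ spine-head sM →
               ∃ λ T → FSp Sg Ψ N T (spine-head sN) B × _⊢_∈∥_∥ₛ_ Sg Ψ M T B
  fsp-covers (⇑ₛ-hd h∶B) _ (⇑ₛ-hd h∶B′) refl = hd _ , fsp-hd h∶B , ∈ₛ-hd h∶B′
  fsp-covers (⇑ₛ-hd h∶B) _ (⇑ₛ-app sM _) same-head =
    contradiction same-head (spine-¬hd-app h∶B sM)
  fsp-covers (⇑ₛ-app sN _) _ (⇑ₛ-hd h∶B) same-head =
    contradiction (sym same-head) (spine-¬hd-app h∶B sN)
  fsp-covers (⇑ₛ-app sN _) (cl-app cM cM′) (⇑ₛ-app sM pM) same-head
    with refl ← spine-dom-unique sN sM same-head
    with T , fsp , M∈T ← fsp-covers sN cM sM same-head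
       | Z , fresh , M′∈Z ← fresh-covers cM′ pM
    = app T l1 Z , fsp-app fsp fresh , ∈ₛ-app M∈T M′∈Z

  InstanceOrComplement : Vec Ty n → Tm n → Tm n → Ty → Set
  InstanceOrComplement Ψ N M A =
    _⊢_∈∥_∥∶_ Sg Ψ M N A
    ⊎ ∃ λ Q → _⊢Not_⇒_∶_ Sg Ψ N Q A × _⊢_∈∥_∥∶_ Sg Ψ M Q A

  SpineInstanceOrComplement : Vec Ty n → Tm n → Tm n → Ty → Set
  SpineInstanceOrComplement Ψ N M B =
    _⊢_∈∥_∥ₛ_ Sg Ψ M N B ⊎ ∃ λ T → NSp Sg Ψ N T B × _⊢_∈∥_∥ₛ_ Sg Ψ M T B

  evar-instance-or-complement : ∀ Φ {a} → Closed M → _⊢_⇑_ Sg Ψ M (base a) →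
                                InstanceOrComplement Ψ (evar Φ) M (base a)
  evar-instance-or-complement {M = M} Φ c p with consistent-or-violated Φ M
  ... | inj₁ Φ✓ = inj₁ (∈-evar (typed-if-consistent c p Φ✓))
  ... | inj₂ (i , ¬ok) with not-lu , ok ← disagrees⇒notL-agrees ¬ok
      = inj₂ (evar _ , not-evar i not-lu , ∈-evar (typed-if-consistent c p (consistent-update i ok)))

  instance-or-complement : _⊢_⇑_ Sg Ψ N A → Closed M → _⊢_⇑_ Sg Ψ M A →
                           InstanceOrComplement Ψ N M A
  spine-instance-or-complement : (sN : _⊢_⇑ₛ_ Sg Ψ N B) → Closed M →
                                 (sM : _⊢_⇑ₛ_ Sg Ψ M B) → spine-head sN ≡ spine-head sM →
                                 SpineInstanceOrComplement Ψ N M B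

  instance-or-complement (⇑-lam pN) (cl-lam c) (⇑-lam pM) with instance-or-complement pN c pM
  ... | inj₁ M∈N             = inj₁ (∈-lam M∈N)
  ... | inj₂ (Q , N⇒Q , M∈Q) = inj₂ (lam lu _ Q , not-lam N⇒Q , ∈-lam M∈Q)
  instance-or-complement (⇑-evar {Φ}) c pM = evar-instance-or-complement Φ c pM
  instance-or-complement (⇑-sp sN) c (⇑-sp sM) with spine-head sM ≟ₕ spine-head sN
  ... | no other-head with T , fresh-spine , M∈T ← freshSp-covers c sM
      = inj₂ (T , not-head (spine-hsp sN) fresh-spine other-head , ∈-sp M∈T)
  ... | yes same-head with spine-instance-or-complement sN c sM (sym same-head)
  ...   | inj₁ M∈N             = inj₁ (∈-sp M∈N)
  ...   | inj₂ (T , N⇒T , M∈T) = inj₂ (T , not-arg N⇒T , ∈-sp M∈T)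

  spine-instance-or-complement (⇑ₛ-hd h∶B) _ (⇑ₛ-hd _) refl = inj₁ (∈ₛ-hd h∶B)
  spine-instance-or-complement (⇑ₛ-hd h∶B) _ (⇑ₛ-app sM _) same-head =
    contradiction same-head (spine-¬hd-app h∶B sM)
  spine-instance-or-complement (⇑ₛ-app sN _) _ (⇑ₛ-hd h∶B) same-head =
    contradiction (sym same-head) (spine-¬hd-app h∶B sN)
  spine-instance-or-complement (⇑ₛ-app sN pN) (cl-app cM cM′) (⇑ₛ-app sM pM) same-head
    with refl ← spine-dom-unique sN sM same-head
    with spine-instance-or-complement sN cM sM same-head
  ... | inj₂ (T , N⇒T , M∈T) with Z , fresh , M′∈Z ← fresh-covers cM′ pM
      = inj₂ (app T l1 Z , nsp-later N⇒T fresh , ∈ₛ-app M∈T M′∈Z)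
  ... | inj₁ M∈N with instance-or-complement pN cM′ pM
  ...   | inj₁ M′∈N′              = inj₁ (∈ₛ-app M∈N M′∈N′)
  ...   | inj₂ (Q , N′⇒Q , M′∈Q) with T , fsp , M∈T ← fsp-covers sN cM sM same-head
        = inj₂ (app T l1 Q , nsp-here fsp N′⇒Q , ∈ₛ-app M∈T M′∈Q)

lemma6p6 : (Sg : List Ty) → LAll.All Pos Sg →
           {n : ℕ} (Ψ : Vec Ty n) → VAll.All Pos Ψ →
           (N : Tm n) (A : Ty) → _⊢_⇑_ Sg Ψ N A →
           (M : Tm n) → Closed M → _⊢_⇑_ Sg Ψ M A →
           _⊢_∈∥_∥∶_ Sg Ψ M N A
           ⊎ ∃ (λ Q → _⊢Not_⇒_∶_ Sg Ψ N Q A × _⊢_∈∥_∥∶_ Sg Ψ M Q A)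
lemma6p6 Sg _ _ _ _ _ N⇑A _ closed M⇑A = instance-or-complement Sg N⇑A closed M⇑A
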